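{- Let $w\ge 5$ and $n$ be integers, and let $B\subseteq[n-1]$ be a set with largest element $b$ (with $b=0$ if $B=\emptyset$). If $n\ge w(2b+w^2)$, then there exists a $B$-free $(n,w-1)$ modular Golomb ruler.
   Context: An $(n,w)$ modular Golomb ruler is a set of $w$ elements $\{a_1,\dots,a_w\}\subseteq\mathbb Z_n$ such that all differences $a_i-a_j$ ($1\le i\neq j\le w$), computed in $\mathbb Z_n$, are nonzero and pairwise distinct; the set of these differences is its set of differences. For $B\subseteq[n-1]=\{1,\dots,n-1\}$, such a ruler is $B$-free if no element of $B$, viewed as an element of $\mathbb Z_n$, belongs to its set of differences. -}

module Defs where

open import Data.Nat using (ℕ; zero; suc; _+_; _*_; _∸_; _≤_; _<_; _≤?_)
open import Data.Fin using (Fin)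
open import Data.Product using (_×_)
open import Data.Sum using (_⊎_)
open import Data.Empty using (⊥)
open import Relation.Nullary using (¬_; yes; no)
open import Relation.Binary.PropositionalEquality using (_≡_; _≢_)

-- Elements of ℤ_n are represented by their canonical residues 0,…,n-1.
-- Difference x - y computed in ℤ_n, for residues x y < n.
diffMod : ℕ → ℕ → ℕ → ℕ
diffMod n x y with y ≤? x
... | yes _ = x ∸ y
... | no  _ = (n + x) ∸ y

record IsModGolombRuler (n w : ℕ) (a : Fin w → ℕ) : Set where
  field
    inRange  : ∀ i → a i < n
    distinct : ∀ i j → i ≢ j → a i ≢ a j
    nonzero  : ∀ i j → i ≢ j → diffMod n (a i) (a j) ≢ 0
    diffsDistinct : ∀ i j k l → i ≢ j → k ≢ l →
                    diffMod n (a i) (a j) ≡ diffMod n (a k) (a l) →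
                    (i ≡ k × j ≡ l)

-- B-free: no element of B (⊆ [n-1], hence already a residue) is a difference.
IsBFree : (n w : ℕ) → (B : ℕ → Set) → (a : Fin w → ℕ) → Set
IsBFree n w B a = ∀ i j → i ≢ j → ¬ B (diffMod n (a i) (a j))

SubsetOfRange : (n : ℕ) → (B : ℕ → Set) → Set
SubsetOfRange n B = ∀ x → B x → (1 ≤ x × x < n)

IsMaxOrZero : (B : ℕ → Set) → ℕ → Set
IsMaxOrZero B b = (B b × (∀ x → B x → x ≤ b)) ⊎ (b ≡ 0 × (∀ x → ¬ B x))

{-# OPTIONS --safe #-}
-- The ruler is i ↦ i·K + tri i for 0 ≤ i ≤ w − 2, with tri i = i(i − 1)/2 and K = b + 1 + tri (w − 2).
-- For i = p + j its difference is p·K + (p·j + tri p), whose low digit is at most tri (p + j) < K,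
-- so reading it in base K recovers p and then j: the ruler is Golomb in ℕ with all gaps ≥ K > b.
-- Its elements are at most M = (w − 2)·K + tri (w − 2). Modulo n the differences a i − a j with
-- j < i stay in (b, M], while the others wrap around to n − (a j − a i) ≥ n − M > M + b, because
-- w(2b + w²) > 2M + b. Hence the two kinds never collide and none lies in B.
module Submission where

open import Defs
open import Data.Nat using (ℕ; zero; suc; _+_; _*_; _∸_; _≤_; _<_; _≤?_; z≤n; s≤s; >-nonZero)
open import Data.Nat.Properties
open import Data.Nat.Tactic.RingSolver using (solve-∀)
open import Data.Fin as Fin using (Fin; toℕ)
open import Data.Fin.Properties as Finₚ using (toℕ-injective; toℕ≤pred[n])
open import Data.Product using (Σ; _×_; _,_; proj₁; proj₂; swap)
open import Data.Sum using (inj₁; inj₂)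
open import Function using (_∘′_)
open import Relation.Nullary using (yes; no; contradiction)
open import Relation.Binary.Definitions using (tri<; tri≈; tri>)
open import Relation.Binary.PropositionalEquality

tri : ℕ → ℕ
tri zero    = 0
tri (suc x) = tri x + x

tri-+ : ∀ p j → tri (p + j) ≡ tri j + (p * j + tri p)
tri-+ zero    j = sym (+-identityʳ (tri j))
tri-+ (suc p) j = begin
  tri (p + j) + (p + j)              ≡⟨ cong (_+ (p + j)) (tri-+ p j) ⟩
  tri j + (p * j + tri p) + (p + j)  ≡⟨ regroup (tri j) (tri p) p j ⟩
  tri j + (suc p * j + (tri p + p))  ∎
  where
  open ≡-Reasoning
  regroup : ∀ u v p j → u + (p * j + v) + (p + j) ≡ u + (suc p * j + (v + p))
  regroup = solve-∀

tri-mono-≤ : ∀ {x y} → x ≤ y → tri x ≤ tri y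
tri-mono-≤ {x} {y} x≤y = begin
  tri x                                     ≤⟨ m≤m+n (tri x) _ ⟩
  tri x + ((y ∸ x) * x + tri (y ∸ x))       ≡⟨ tri-+ (y ∸ x) x ⟨
  tri (y ∸ x + x)                           ≡⟨ cong tri (m∸n+n≡m x≤y) ⟩
  tri y                                     ∎
  where open ≤-Reasoning

2*tri[n]+n≡n*n : ∀ n → 2 * tri n + n ≡ n * n
2*tri[n]+n≡n*n zero    = refl
2*tri[n]+n≡n*n (suc n) = begin
  2 * (tri n + n) + suc n       ≡⟨ regroup (tri n) n ⟩
  2 * tri n + n + (2 * n + 1)   ≡⟨ cong (_+ (2 * n + 1)) (2*tri[n]+n≡n*n n) ⟩
  n * n + (2 * n + 1)           ≡⟨ square n ⟩
  suc n * suc n                 ∎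
  where
  open ≡-Reasoning
  regroup : ∀ u n → 2 * (u + n) + suc n ≡ 2 * u + n + (2 * n + 1)
  regroup = solve-∀
  square : ∀ n → n * n + (2 * n + 1) ≡ suc n * suc n
  square = solve-∀

*-+-<-mono : ∀ K {p q} x y → x < K → p < q → p * K + x < q * K + y
*-+-<-mono K {p} {q} x y x<K p<q = begin-strict
  p * K + x  <⟨ +-monoʳ-< (p * K) x<K ⟩
  p * K + K  ≡⟨ +-comm (p * K) K ⟩
  suc p * K  ≤⟨ *-monoˡ-≤ K p<q ⟩
  q * K      ≤⟨ m≤m+n (q * K) y ⟩
  q * K + y  ∎
  where open ≤-Reasoning

quotient-unique : ∀ K {p q x y} → x < K → y < K → p * K + x ≡ q * K + y → p ≡ q
quotient-unique K {p} {q} {x} {y} x<K y<K eq with <-cmp p q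
... | tri< p<q _ _ = contradiction eq (<⇒≢ (*-+-<-mono K x y x<K p<q))
... | tri≈ _ p≡q _ = p≡q
... | tri> _ _ q<p = contradiction eq (>⇒≢ (*-+-<-mono K y x y<K q<p))

diffMod≡∸ : ∀ n {x y} → y ≤ x → diffMod n x y ≡ x ∸ y
diffMod≡∸ n {x} {y} y≤x with y ≤? x
... | yes _   = refl
... | no y≰x  = contradiction y≤x y≰x

diffMod≡n∸ : ∀ n {x y} → x < y → diffMod n x y ≡ n ∸ (y ∸ x)
diffMod≡n∸ n {x} {y} x<y with y ≤? x
... | yes y≤x = contradiction y≤x (<⇒≱ x<y)
... | no _    = begin
  n + x ∸ y              ≡⟨ cong₂ _∸_ (+-comm n x) (sym (m+[n∸m]≡n (<⇒≤ x<y))) ⟩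
  x + n ∸ (x + (y ∸ x))  ≡⟨ [m+n]∸[m+o]≡n∸o x n (y ∸ x) ⟩
  n ∸ (y ∸ x)            ∎
  where open ≡-Reasoning

record IsGolombRuler {w : ℕ} (a : Fin w → ℕ) : Set where
  field
    increasing      : ∀ {i j} → j Fin.< i → a j < a i
    diffs-injective : ∀ {i j k l} → j Fin.< i → l Fin.< k →
                      a i ∸ a j ≡ a k ∸ a l → i ≡ k × j ≡ l

module _ {w : ℕ} {a : Fin w → ℕ} (ruler : IsGolombRuler a)
         {n M : ℕ} (a≤M : ∀ i → a i ≤ M) where

  open IsGolombRuler ruler

  private
    diffMod-descending : ∀ {i j} → j Fin.< i → diffMod n (a i) (a j) ≡ a i ∸ a j
    diffMod-descending j<i = diffMod≡∸ n (<⇒≤ (increasing j<i))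

    diffMod-descending-≤ : ∀ {i j} → j Fin.< i → diffMod n (a i) (a j) ≤ M
    diffMod-descending-≤ {i} {j} j<i =
      subst (_≤ M) (sym (diffMod-descending j<i)) (≤-trans (m∸n≤m (a i) (a j)) (a≤M i))

    diffMod-ascending-> : ∀ {c i j} → c + M < n → i Fin.< j → c < diffMod n (a i) (a j)
    diffMod-ascending-> {c} {i} {j} c+M<n i<j = begin-strict
      c                  <⟨ m+n≤o⇒m≤o∸n (suc c) c+M<n ⟩
      n ∸ M              ≤⟨ ∸-monoʳ-≤ n (≤-trans (m∸n≤m (a j) (a i)) (a≤M j)) ⟩
      n ∸ (a j ∸ a i)    ≡⟨ diffMod≡n∸ n (increasing i<j) ⟨
      diffMod n (a i) (a j) ∎
      where open ≤-Reasoning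

    diffMod-> : ∀ c → c + M < n → (∀ {i j} → j Fin.< i → c < a i ∸ a j) →
                ∀ {i j} → i ≢ j → c < diffMod n (a i) (a j)
    diffMod-> c c+M<n gaps {i} {j} i≢j with Finₚ.<-cmp i j
    ... | tri< i<j _ _ = diffMod-ascending-> c+M<n i<j
    ... | tri≈ _ i≡j _ = contradiction i≡j i≢j
    ... | tri> _ _ j<i = subst (c <_) (sym (diffMod-descending j<i)) (gaps j<i)

  isModGolombRuler : M + M < n → IsModGolombRuler n w a
  isModGolombRuler M+M<n = record
    { inRange       = λ i → ≤-<-trans (a≤M i) M<n
    ; distinct      = distinct
    ; nonzero       = λ i j i≢j → >⇒≢ (diffMod-> 0 M<n (m<n⇒0<n∸m ∘′ increasing) i≢j)
    ; diffsDistinct = diffsDistinct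
    }
    where
    M<n : M < n
    M<n = ≤-<-trans (m≤n+m M M) M+M<n

    wrapped≤n : ∀ {i j} → i Fin.< j → a j ∸ a i ≤ n
    wrapped≤n {i} {j} _ = ≤-trans (m∸n≤m (a j) (a i)) (≤-trans (a≤M j) (<⇒≤ M<n))

    distinct : ∀ i j → i ≢ j → a i ≢ a j
    distinct i j i≢j with Finₚ.<-cmp i j
    ... | tri< i<j _ _ = <⇒≢ (increasing i<j)
    ... | tri≈ _ i≡j _ = contradiction i≡j i≢j
    ... | tri> _ _ j<i = >⇒≢ (increasing j<i)

    diffsDistinct : ∀ i j k l → i ≢ j → k ≢ l →
                    diffMod n (a i) (a j) ≡ diffMod n (a k) (a l) → i ≡ k × j ≡ l
    diffsDistinct i j k l i≢j k≢l eq with Finₚ.<-cmp i j | Finₚ.<-cmp k l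
    ... | tri≈ _ i≡j _ | _            = contradiction i≡j i≢j
    ... | _            | tri≈ _ k≡l _ = contradiction k≡l k≢l
    ... | tri> _ _ j<i | tri> _ _ l<k = diffs-injective j<i l<k
      (trans (sym (diffMod-descending j<i)) (trans eq (diffMod-descending l<k)))
    ... | tri< i<j _ _ | tri< k<l _ _ = swap (diffs-injective i<j k<l
      (∸-cancelˡ-≡ (wrapped≤n i<j) (wrapped≤n k<l)
        (trans (sym (diffMod≡n∸ n (increasing i<j))) (trans eq (diffMod≡n∸ n (increasing k<l))))))
    ... | tri> _ _ j<i | tri< k<l _ _ =
      contradiction eq (<⇒≢ (≤-<-trans (diffMod-descending-≤ j<i) (diffMod-ascending-> M+M<n k<l)))
    ... | tri< i<j _ _ | tri> _ _ l<k =
      contradiction eq (>⇒≢ (≤-<-trans (diffMod-descending-≤ l<k) (diffMod-ascending-> M+M<n i<j)))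

  isBFree : (B : ℕ → Set) {b : ℕ} → (∀ x → B x → x ≤ b) →
            (∀ {i j} → j Fin.< i → b < a i ∸ a j) → b + M < n → IsBFree n w B a
  isBFree B {b} B≤b gaps b+M<n i j i≢j Bd = <⇒≱ (diffMod-> b b+M<n gaps i≢j) (B≤b _ Bd)

quadratic : ℕ → ℕ → ℕ
quadratic K x = x * K + tri x

gap : ℕ → ℕ → ℕ → ℕ
gap K p j = p * K + (p * j + tri p)

quadratic-+ : ∀ K p j → quadratic K (p + j) ≡ quadratic K j + gap K p j
quadratic-+ K p j = begin
  (p + j) * K + tri (p + j)                   ≡⟨ cong ((p + j) * K +_) (tri-+ p j) ⟩
  (p + j) * K + (tri j + (p * j + tri p))     ≡⟨ regroup p j K (tri j) (p * j + tri p) ⟩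
  j * K + tri j + (p * K + (p * j + tri p))   ∎
  where
  open ≡-Reasoning
  regroup : ∀ p j K u v → (p + j) * K + (u + v) ≡ j * K + u + (p * K + v)
  regroup = solve-∀

quadratic-∸ : ∀ K {i j} → j ≤ i → quadratic K i ∸ quadratic K j ≡ gap K (i ∸ j) j
quadratic-∸ K {i} {j} j≤i = begin
  quadratic K i ∸ quadratic K j                           ≡⟨ cong (λ x → quadratic K x ∸ quadratic K j) (m∸n+n≡m j≤i) ⟨
  quadratic K (i ∸ j + j) ∸ quadratic K j                 ≡⟨ cong (_∸ quadratic K j) (quadratic-+ K (i ∸ j) j) ⟩
  quadratic K j + gap K (i ∸ j) j ∸ quadratic K j         ≡⟨ m+n∸m≡n (quadratic K j) (gap K (i ∸ j) j) ⟩
  gap K (i ∸ j) j                                         ∎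
  where open ≡-Reasoning

quadratic-mono-≤ : ∀ K {x y} → x ≤ y → quadratic K x ≤ quadratic K y
quadratic-mono-≤ K x≤y = +-mono-≤ (*-monoˡ-≤ K x≤y) (tri-mono-≤ x≤y)

gap-≥ : ∀ K {p} j → 0 < p → K ≤ gap K p j
gap-≥ K {p} j 0<p = ≤-trans (m≤n*m K p {{>-nonZero 0<p}}) (m≤m+n (p * K) _)

module _ {t K : ℕ} (tri[t]<K : tri t < K) where

  private
    low-digit< : ∀ {p j} → p + j ≤ t → p * j + tri p < K
    low-digit< {p} {j} p+j≤t = ≤-<-trans bound tri[t]<K
      where
      bound : p * j + tri p ≤ tri t
      bound = begin
        p * j + tri p              ≤⟨ m≤n+m _ (tri j) ⟩
        tri j + (p * j + tri p)    ≡⟨ tri-+ p j ⟨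
        tri (p + j)                ≤⟨ tri-mono-≤ p+j≤t ⟩
        tri t                      ∎
        where open ≤-Reasoning

  gap-injective : ∀ {p j q l} → p + j ≤ t → q + l ≤ t → 0 < p →
                  gap K p j ≡ gap K q l → p ≡ q × j ≡ l
  gap-injective {p} {j} {q} {l} p+j≤t q+l≤t 0<p eq
    with quotient-unique K {p} {q} (low-digit< {p} {j} p+j≤t) (low-digit< {q} {l} q+l≤t) eq
  ... | refl = refl , *-cancelˡ-≡ j _ p {{>-nonZero 0<p}}
                        (+-cancelʳ-≡ _ _ _ (+-cancelˡ-≡ (p * K) _ _ eq))

  quadraticRuler : Fin (suc t) → ℕ
  quadraticRuler i = quadratic K (toℕ i)

  quadraticRuler-∸ : ∀ {i j} → j Fin.< i →
                     quadraticRuler i ∸ quadraticRuler j ≡ gap K (toℕ i ∸ toℕ j) (toℕ j)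
  quadraticRuler-∸ j<i = quadratic-∸ K (<⇒≤ j<i)

  quadraticRuler-gap : ∀ {i j} → j Fin.< i → K ≤ quadraticRuler i ∸ quadraticRuler j
  quadraticRuler-gap {i} {j} j<i =
    subst (K ≤_) (sym (quadraticRuler-∸ j<i)) (gap-≥ K (toℕ j) (m<n⇒0<n∸m j<i))

  quadraticRuler-≤ : ∀ i → quadraticRuler i ≤ quadratic K t
  quadraticRuler-≤ i = quadratic-mono-≤ K (toℕ≤pred[n] i)

  isGolombRuler : IsGolombRuler quadraticRuler
  isGolombRuler = record { increasing = increasing ; diffs-injective = diffs-injective }
    where
    increasing : ∀ {i j} → j Fin.< i → quadraticRuler j < quadraticRuler i
    increasing {i} {j} j<i = begin-strict
      quadratic K (toℕ j)                         <⟨ m<m+n _ (<-≤-trans (≤-<-trans z≤n tri[t]<K) (gap-≥ K (toℕ j) 0<p)) ⟩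
      quadratic K (toℕ j) + gap K p (toℕ j)       ≡⟨ quadratic-+ K p (toℕ j) ⟨
      quadratic K (p + toℕ j)                     ≡⟨ cong (quadratic K) (m∸n+n≡m (<⇒≤ j<i)) ⟩
      quadratic K (toℕ i)                         ∎
      where
      open ≤-Reasoning
      p : ℕ
      p = toℕ i ∸ toℕ j
      0<p : 0 < p
      0<p = m<n⇒0<n∸m j<i

    digits≤t : ∀ {i j : Fin (suc t)} → j Fin.< i → toℕ i ∸ toℕ j + toℕ j ≤ t
    digits≤t {i} j<i = subst (_≤ t) (sym (m∸n+n≡m (<⇒≤ j<i))) (toℕ≤pred[n] i)

    diffs-injective : ∀ {i j k l} → j Fin.< i → l Fin.< k →
                      quadraticRuler i ∸ quadraticRuler j ≡ quadraticRuler k ∸ quadraticRuler l →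
                      i ≡ k × j ≡ l
    diffs-injective {i} {j} {k} {l} j<i l<k eq = toℕ-injective i≡k , toℕ-injective j≡l
      where
      digits≡ : toℕ i ∸ toℕ j ≡ toℕ k ∸ toℕ l × toℕ j ≡ toℕ l
      digits≡ = gap-injective (digits≤t j<i) (digits≤t l<k) (m<n⇒0<n∸m j<i)
        (trans (sym (quadraticRuler-∸ j<i)) (trans eq (quadraticRuler-∸ l<k)))
      j≡l : toℕ j ≡ toℕ l
      j≡l = proj₂ digits≡
      i≡k : toℕ i ≡ toℕ k
      i≡k = begin
        toℕ i                  ≡⟨ m∸n+n≡m (<⇒≤ j<i) ⟨
        toℕ i ∸ toℕ j + toℕ j  ≡⟨ cong₂ _+_ (proj₁ digits≡) j≡l ⟩
        toℕ k ∸ toℕ l + toℕ l  ≡⟨ m∸n+n≡m (<⇒≤ l<k) ⟩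
        toℕ k                  ∎
        where open ≡-Reasoning

-- The slack 5t² + 12t + 3b + 2·tri t + 7 is what the cubic bound leaves over 2M + b + 1.
quadratic-capacity : ∀ t b → let w = suc (suc t); M = quadratic (suc (b + tri t)) t in
                     M + (b + M) < w * (2 * b + w * w)
quadratic-capacity t b = begin
  suc (M + (b + M))                                   ≤⟨ m≤m+n _ (5 * (t * t) + 12 * t + 3 * b + 2 * T + 7) ⟩
  suc (M + (b + M)) + (5 * (t * t) + 12 * t + 3 * b + 2 * T + 7)
                                                      ≡⟨ expand t b T ⟩
  w * (2 * b + (2 * T + t + 4 * t + 4))               ≡⟨ cong (λ s → w * (2 * b + (s + 4 * t + 4))) (2*tri[n]+n≡n*n t) ⟩
  w * (2 * b + (t * t + 4 * t + 4))                   ≡⟨ cong (λ s → w * (2 * b + s)) (square t) ⟩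
  w * (2 * b + w * w)                                 ∎
  where
  open ≤-Reasoning
  T w M : ℕ
  T = tri t
  w = suc (suc t)
  M = quadratic (suc (b + T)) t
  expand : ∀ t b T →
           suc (t * suc (b + T) + T + (b + (t * suc (b + T) + T))) + (5 * (t * t) + 12 * t + 3 * b + 2 * T + 7)
             ≡ suc (suc t) * (2 * b + (2 * T + t + 4 * t + 4))
  expand = solve-∀
  square : ∀ t → t * t + 4 * t + 4 ≡ suc (suc t) * suc (suc t)
  square = solve-∀

IsMaxOrZero⇒upperBound : ∀ {B b} → IsMaxOrZero B b → ∀ x → B x → x ≤ b
IsMaxOrZero⇒upperBound (inj₁ (_ , B≤b)) = B≤b
IsMaxOrZero⇒upperBound (inj₂ (_ , B≡∅)) x Bx = contradiction Bx (B≡∅ x)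

lemma2 : (w n : ℕ) → 5 ≤ w → (B : ℕ → Set) → SubsetOfRange n B →
         (b : ℕ) → IsMaxOrZero B b →
         w * (2 * b + w * w) ≤ n →
         Σ (Fin (w ∸ 1) → ℕ) (λ a → IsModGolombRuler n (w ∸ 1) a × IsBFree n (w ∸ 1) B a)
lemma2 zero          _ ()
lemma2 (suc zero)    _ (s≤s ())
lemma2 (suc (suc t)) n _ B _ b maxB w[2b+w²]≤n =
  quadraticRuler tri[t]<K ,
  isModGolombRuler ruler bounded (≤-<-trans (+-monoʳ-≤ M (m≤n+m M b)) M+[b+M]<n) ,
  isBFree ruler bounded B (IsMaxOrZero⇒upperBound maxB)
          (λ j<i → <-≤-trans b<K (quadraticRuler-gap tri[t]<K j<i))
          (≤-<-trans (m≤n+m (b + M) M) M+[b+M]<n)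
  where
  K M : ℕ
  K = suc (b + tri t)
  M = quadratic K t
  tri[t]<K : tri t < K
  tri[t]<K = s≤s (m≤n+m (tri t) b)
  b<K : b < K
  b<K = s≤s (m≤m+n b (tri t))
  ruler : IsGolombRuler (quadraticRuler tri[t]<K)
  ruler = isGolombRuler tri[t]<K
  bounded : ∀ i → quadraticRuler tri[t]<K i ≤ M
  bounded = quadraticRuler-≤ tri[t]<K
  M+[b+M]<n : M + (b + M) < n
  M+[b+M]<n = <-≤-trans (quadratic-capacity t b) w[2b+w²]≤n
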